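{- Let $M,M_1,M_2\in\mathcal M$ and $r\in\{\beta,\beta\eta,h\}$. (1) If $M\rhd^*_rM_1$ and $M\rhd^*_rM_2$, then there is $M'$ such that $M_1\rhd^*_rM'$ and $M_2\rhd^*_rM'$. (2) $M_1\simeq_rM_2$ iff there is a term $M$ such that $M_1\rhd^*_rM$ and $M_2\rhd^*_rM$.
   Context: Indexes: finite sequences of natural numbers ($\mathcal L_{\mathbb N}$), $\oslash$ empty, $i::L$ prepending $i$, $L_1\preceq L_2$ (also $L_2\succeq L_1$) iff $L_2=L_1::L_3$ for some $L_3$ (concatenation). Terms: over a countably infinite set $\mathcal V$ of variables, terms $\mathcal M$, free indexed variables $\mathrm{fv}$, degree $d$, joinability $\diamond$ are defined simultaneously: $x^L\in\mathcal M$ ($\mathrm{fv}=\{x^L\}$, $d=L$); $MN\in\mathcal M$ when $d(M)\preceq d(N)$ and $M\diamond N$ ($\mathrm{fv}$ union, $d(MN)=d(M)$); $\lambda x^L.M\in\mathcal M$ when $L\succeq d(M)$ ($\mathrm{fv}(M)\setminus\{x^L\}$, $d=d(M)$). $M\diamond N$ iff whenever $x^L\in\mathrm{fv}(M)$, $x^K\in\mathrm{fv}(N)$ then $L=K$. Terms are modulo $\alpha$-conversion; capture-avoiding substitution $M[x^L:=N]$ is defined only if $M\diamond N$ and $d(N)=L$. A relation on $\mathcal M$ is compatible if it is preserved by $\lambda$-abstraction and by application on either side whenever the resulting expressions are terms. $\rhd_\beta$: least compatible relation containing $(\lambda x^L.M)N\rhd_\beta M[x^L:=N]$ when $d(N)=L$;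 $\rhd_\eta$: least compatible relation containing $\lambda x^L.(Mx^L)\rhd_\eta M$ when $x^L\notin\mathrm{fv}(M)$; $\rhd_{\beta\eta}=\rhd_\beta\cup\rhd_\eta$; weak head reduction $(\lambda x^L.M)NN_1\dots N_n\rhd_h M[x^L:=N]N_1\dots N_n$ ($n\ge0$). $\rhd^*_r$ is the reflexive–transitive closure of $\rhd_r$, and $\simeq_r$ the equivalence relation induced by $\rhd^*_r$. -}

module Defs where

open import Data.Nat using (ℕ; zero; suc; pred; _<ᵇ_; _≡ᵇ_)
open import Data.Bool using (if_then_else_)
open import Data.Sum using (_⊎_)
open import Data.List using (List; []; _∷_; _++_)
open import Data.Product using (_×_; _,_; ∃)
open import Data.List.Membership.Propositional using (_∈_)
open import Relation.Binary.PropositionalEquality using (_≡_)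
open import Relation.Binary.Construct.Closure.ReflexiveTransitive using (Star)
open import Relation.Binary.Construct.Closure.Equivalence using (EqClosure)

Index : Set
Index = List ℕ

_≼_ : Index → Index → Set
L₁ ≼ L₂ = ∃ λ L₃ → L₂ ≡ L₁ ++ L₃

-- Raw expressions, locally nameless-style: free indexed variables x^L
-- are named (names x ∈ ℕ, a countably infinite set of variables);
-- bound variables are de Bruijn indices, so α-equivalent terms are
-- syntactically equal.

data Tm : Set where
  free  : ℕ → Index → Tm
  bound : ℕ → Tm
  _·_   : Tm → Tm → Tm
  ƛ     : Index → Tm → Tm         -- λ x^L . M  (binder carries its index L)

infixl 7 _·_

fv : Tm → List (ℕ × Index)
fv (free x L) = (x , L) ∷ []
fv (bound i)  = []
fv (M · N)    = fv M ++ fv N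
fv (ƛ L M)    = fv M

_⋄_ : Tm → Tm → Set
M ⋄ N = ∀ {x L K} → (x , L) ∈ fv M → (x , K) ∈ fv N → L ≡ K

-- contexts of enclosing binders' indexes (innermost first)
Ctx : Set
Ctx = List Index

data _∋_∶_ : Ctx → ℕ → Index → Set where
  here  : ∀ {Γ L} → (L ∷ Γ) ∋ zero ∶ L
  there : ∀ {Γ L K i} → Γ ∋ i ∶ L → (K ∷ Γ) ∋ suc i ∶ L

-- WF Γ M L : M is a term (under binders Γ) of degree L
data WF (Γ : Ctx) : Tm → Index → Set where
  wf-free  : ∀ {x L} → WF Γ (free x L) L
  wf-bound : ∀ {i L} → Γ ∋ i ∶ L → WF Γ (bound i) L
  wf-app   : ∀ {M N K K′} → WF Γ M K → WF Γ N K′ → K ≼ K′ → M ⋄ N →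
             WF Γ (M · N) K
  wf-lam   : ∀ {M L K} → WF (L ∷ Γ) M K → K ≼ L → WF Γ (ƛ L M) K

TermIn : Ctx → Tm → Set
TermIn Γ M = ∃ λ K → WF Γ M K

-- membership in 𝓜
Term : Tm → Set
Term = TermIn []

↑ : ℕ → Tm → Tm
↑ c (free x L) = free x L
↑ c (bound i)  = if i <ᵇ c then bound i else bound (suc i)
↑ c (M · N)    = ↑ c M · ↑ c N
↑ c (ƛ L M)    = ƛ L (↑ (suc c) M)

sub : ℕ → Tm → Tm → Tm
sub j N (free x L) = free x L
sub j N (bound i)  = if i <ᵇ j then bound i
                     else (if i ≡ᵇ j then N else bound (pred i))
sub j N (M · P)    = sub j N M · sub j N P
sub j N (ƛ L M)    = ƛ L (sub (suc j) (↑ 0 N) M)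

data Red : Set where
  β βη h : Red

data Axiom : Red → Ctx → Tm → Tm → Set where
  β-ax  : ∀ {r Γ L M N} → (r ≡ β ⊎ r ≡ βη) →
          TermIn Γ ((ƛ L M) · N) → WF Γ N L → TermIn Γ (sub 0 N M) →
          Axiom r Γ ((ƛ L M) · N) (sub 0 N M)
  η-ax  : ∀ {Γ L M} →
          -- x^L ∉ fv(M): the body is the shift of M (does not use bound 0)
          TermIn Γ (ƛ L (↑ 0 M · bound 0)) → TermIn Γ M →
          Axiom βη Γ (ƛ L (↑ 0 M · bound 0)) M

data CStep (r : Red) : Ctx → Tm → Tm → Set where
  ax   : ∀ {Γ M N} → Axiom r Γ M N → CStep r Γ M N
  appˡ : ∀ {Γ M M′ N} → CStep r Γ M M′ →
         TermIn Γ (M · N) → TermIn Γ (M′ · N) → CStep r Γ (M · N) (M′ · N)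
  appʳ : ∀ {Γ M N N′} → CStep r Γ N N′ →
         TermIn Γ (M · N) → TermIn Γ (M · N′) → CStep r Γ (M · N) (M · N′)
  lam  : ∀ {Γ L M M′} → CStep r (L ∷ Γ) M M′ →
         TermIn Γ (ƛ L M) → TermIn Γ (ƛ L M′) → CStep r Γ (ƛ L M) (ƛ L M′)

-- weak head reduction: (λx^L.M) N N₁ … Nₙ ▷ M[x^L:=N] N₁ … Nₙ
data HStep : Tm → Tm → Set where
  hβ   : ∀ {L M N} → Term ((ƛ L M) · N) → WF [] N L → Term (sub 0 N M) →
         HStep ((ƛ L M) · N) (sub 0 N M)
  happ : ∀ {M M′ P} → HStep M M′ → Term (M · P) → Term (M′ · P) →
         HStep (M · P) (M′ · P)

_▷[_]_ : Tm → Red → Tm → Set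
M ▷[ β ]  N = CStep β [] M N
M ▷[ βη ] N = CStep βη [] M N
M ▷[ h ]  N = HStep M N

_▷*[_]_ : Tm → Red → Tm → Set
M ▷*[ r ] N = Star (λ P Q → P ▷[ r ] Q) M N

_≃[_]_ : Tm → Red → Tm → Set
M ≃[ r ] N = EqClosure (λ P Q → P ▷[ r ] Q) M N

module Submission where

-- Abstract rewriting first: the diamond property lifts to R*, so R is
-- confluent whenever R ⊆ S ⊆ R* for a diamond S; Hindley–Rosen handles a
-- union of commuting confluent relations.  Raw β-reduction (on expressions,
-- keeping only the degree side condition) is confluent by Tait–Martin-Löf:
-- parallel reduction is diamond by the triangle lemma for complete
-- developments.  Raw η is subcommutative and strongly commutes with β, so
-- raw βη is confluent.  Subject reduction then reads raw reductions from a
-- term as reductions of ▷_r, transferring confluence; h is deterministic.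
-- Finally, for any confluent relation between terms a conversion zig-zag
-- closes to a common reduct, which gives both parts of the theorem.

open import Defs
open import Level using (0ℓ)
open import Data.Product using (_×_; ∃; _,_; proj₁; proj₂)
open import Data.Sum using (_⊎_; inj₁; inj₂) renaming (map to ⊎-map)
open import Data.Empty using (⊥-elim)
open import Data.Bool using (true; false)
open import Data.Nat using (ℕ; zero; suc; pred; _<ᵇ_; _≡ᵇ_; _≤_; _<_; z≤n; s≤s; _<?_; _≟_)
open import Data.Nat.Properties
  using (≤-refl; ≤-trans; <⇒≤; <-irrefl; m≤n⇒m≤1+n; ≮⇒≥; <-cmp; n≤1+n; suc-injective)
open import Data.List using (List; []; _∷_; _++_; length)
open import Data.List.Properties using (≡-dec)
open import Data.List.Membership.Propositional using (_∈_)
open import Data.List.Membership.Propositional.Properties using (∈-++⁺ˡ; ∈-++⁺ʳ; ∈-++⁻)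
open import Data.List.Relation.Binary.Subset.Propositional using (_⊆_)
open import Data.List.Relation.Binary.Subset.Propositional.Properties using (⊆-refl; ++⁺)
import Data.List.Relation.Unary.Any as Any
open import Relation.Nullary using (Dec; yes; no)
open import Relation.Binary.Core using (Rel; _⇒_)
open import Relation.Binary.Definitions using (tri<; tri≈; tri>)
open import Relation.Binary.PropositionalEquality
  using (_≡_; _≢_; refl; sym; trans; cong; cong₂; subst)
open import Relation.Binary.Construct.Union using (_∪_)
open import Relation.Binary.Construct.Closure.Reflexive using (ReflClosure; [_])
  renaming (refl to stay)
import Relation.Binary.Construct.Closure.Reflexive as Refl
open import Relation.Binary.Construct.Closure.ReflexiveTransitive using (Star; ε; _◅_; _◅◅_)
import Relation.Binary.Construct.Closure.ReflexiveTransitive as Star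
open import Relation.Binary.Construct.Closure.Symmetric using (fwd; bwd)
open import Relation.Binary.Construct.Closure.Equivalence using (EqClosure)
open import Relation.Binary.Construct.Closure.Equivalence.Properties
  using (a—↠b⇒a↔b; a—↠b⇒b↔a)
open import Relation.Binary.Rewriting using (Confluent; det⇒conf)

module AbstractRewriting {A : Set} where

  Diamond : Rel A 0ℓ → Set
  Diamond R = ∀ {a b c} → R a b → R a c → ∃ λ d → R b d × R c d

  strip : ∀ {R : Rel A 0ℓ} → Diamond R → ∀ {a b c} → R a b → Star R a c → ∃ λ d → Star R b d × R c d
  strip ◇ {b = b} ab ε = b , ε , ab
  strip ◇ ab (ac₁ ◅ c₁c) with ◇ ab ac₁
  ... | e , be , c₁e with strip ◇ c₁e c₁c
  ...   | d , ed , cd = d , be ◅ ed , cd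

  diamond-star : ∀ {R : Rel A 0ℓ} → Diamond R → Diamond (Star R)
  diamond-star ◇ {c = c} ε ac = c , ac , ε
  diamond-star ◇ (ab₁ ◅ b₁b) ac with strip ◇ ab₁ ac
  ... | e , b₁e , ce with diamond-star ◇ b₁b b₁e
  ...   | d , bd , ed = d , bd , ce ◅ ed

  -- If R ⊆ S ⊆ R* and S has the diamond property then R is confluent,
  -- since then R* = S*.
  diamond-between : ∀ {R S : Rel A 0ℓ} → R ⇒ S → S ⇒ Star R → Diamond S → Confluent R
  diamond-between R⊆S S⊆R* ◇ p q with diamond-star ◇ (Star.map R⊆S p) (Star.map R⊆S q)
  ... | d , bd , cd = d , Star.concat (Star.map S⊆R* bd) , Star.concat (Star.map S⊆R* cd)

  refl-star : ∀ {R : Rel A 0ℓ} → ReflClosure R ⇒ Star R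
  refl-star stay = ε
  refl-star [ r ] = r ◅ ε

  Subcommutative : Rel A 0ℓ → Set
  Subcommutative R = ∀ {a b c} → R a b → R a c → b ≡ c ⊎ ∃ λ d → R b d × R c d

  -- A subcommutative relation is confluent: its reflexive closure is diamond.
  subcommutative⇒confluent : ∀ {R : Rel A 0ℓ} → Subcommutative R → Confluent R
  subcommutative⇒confluent {R} sc = diamond-between [_] refl-star ◇
    where
    ◇ : Diamond (ReflClosure R)
    ◇ {c = c} stay ac = c , ac , stay
    ◇ {b = b} ab stay = b , stay , ab
    ◇ {b = b} [ ab ] [ ac ] with sc ab ac
    ... | inj₁ refl = b , stay , stay
    ... | inj₂ (d , bd , cd) = d , [ bd ] , [ cd ]

  StronglyCommute : Rel A 0ℓ → Rel A 0ℓ → Set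
  StronglyCommute E B = ∀ {a b c} → E a b → B a c → ∃ λ d → ReflClosure B b d × Star E c d

  commute-star-step : ∀ {E B : Rel A 0ℓ} → StronglyCommute E B →
                      ∀ {a b c} → Star E a b → B a c → ∃ λ d → ReflClosure B b d × Star E c d
  commute-star-step sc {c = c} ε ac = c , [ ac ] , ε
  commute-star-step sc (aa₁ ◅ a₁b) ac with sc aa₁ ac
  ... | e , stay , ce = _ , stay , ce ◅◅ a₁b
  ... | e , [ a₁e ] , ce with commute-star-step sc a₁b a₁e
  ...   | d , bd , ed = d , bd , ce ◅◅ ed

  commute-star : ∀ {E B : Rel A 0ℓ} → StronglyCommute E B →
                 ∀ {a b c} → Star E a b → Star B a c → ∃ λ d → Star B b d × Star E c d
  commute-star sc {b = b} ab ε = b , ε , ab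
  commute-star sc ab (ac₁ ◅ c₁c) with commute-star-step sc ab ac₁
  ... | d₁ , bd₁ , c₁d₁ with commute-star sc c₁d₁ c₁c
  ...   | d , d₁d , cd = d , refl-star bd₁ ◅◅ d₁d , cd

  -- Hindley–Rosen: the union of two confluent relations whose closures
  -- commute is confluent (Star R ∪ Star T is diamond and lies between).
  hindley-rosen : ∀ {R T : Rel A 0ℓ} → Confluent R → Confluent T →
                  (∀ {a b c} → Star T a b → Star R a c → ∃ λ d → Star R b d × Star T c d) →
                  Confluent (R ∪ T)
  hindley-rosen {R} {T} confR confT comm = diamond-between step-in step-out ◇
    where
    step-in : R ∪ T ⇒ Star R ∪ Star T
    step-in (inj₁ r) = inj₁ (r ◅ ε)
    step-in (inj₂ t) = inj₂ (t ◅ ε)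
    step-out : Star R ∪ Star T ⇒ Star (R ∪ T)
    step-out (inj₁ rs) = Star.map inj₁ rs
    step-out (inj₂ ts) = Star.map inj₂ ts
    ◇ : Diamond (Star R ∪ Star T)
    ◇ (inj₁ x) (inj₁ y) with confR x y
    ... | d , u , v = d , inj₁ u , inj₁ v
    ◇ (inj₂ x) (inj₂ y) with confT x y
    ... | d , u , v = d , inj₂ u , inj₂ v
    ◇ (inj₂ x) (inj₁ y) with comm x y
    ... | d , u , v = d , inj₁ u , inj₂ v
    ◇ (inj₁ x) (inj₂ y) with comm y x
    ... | d , u , v = d , inj₂ v , inj₁ u

open AbstractRewriting

-- Equations between de Bruijn shifts ↑ and substitutions sub, used to
-- compute with β- and η-contracta.

<ᵇ-true : ∀ {i j} → i < j → (i <ᵇ j) ≡ true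
<ᵇ-true {zero} {suc j} _ = refl
<ᵇ-true {suc i} {suc j} (s≤s p) = <ᵇ-true p

<ᵇ-false : ∀ {i j} → j ≤ i → (i <ᵇ j) ≡ false
<ᵇ-false {i} {zero} _ = refl
<ᵇ-false {suc i} {suc j} (s≤s p) = <ᵇ-false p

≡ᵇ-refl : ∀ i → (i ≡ᵇ i) ≡ true
≡ᵇ-refl zero = refl
≡ᵇ-refl (suc i) = ≡ᵇ-refl i

≡ᵇ-false : ∀ {i j} → i ≢ j → (i ≡ᵇ j) ≡ false
≡ᵇ-false {zero} {zero} p = ⊥-elim (p refl)
≡ᵇ-false {zero} {suc j} p = refl
≡ᵇ-false {suc i} {zero} p = refl
≡ᵇ-false {suc i} {suc j} p = ≡ᵇ-false (λ e → p (cong suc e))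

↑-below : ∀ {i c} → i < c → ↑ c (bound i) ≡ bound i
↑-below p rewrite <ᵇ-true p = refl

↑-above : ∀ {i c} → c ≤ i → ↑ c (bound i) ≡ bound (suc i)
↑-above p rewrite <ᵇ-false p = refl

sub-below : ∀ {i j N} → i < j → sub j N (bound i) ≡ bound i
sub-below p rewrite <ᵇ-true p = refl

sub-at : ∀ {j N} → sub j N (bound j) ≡ N
sub-at {j} rewrite <ᵇ-false (≤-refl {j}) | ≡ᵇ-refl j = refl

sub-above : ∀ {i j N} → j < i → sub j N (bound i) ≡ bound (pred i)
sub-above {i} {j} p rewrite <ᵇ-false (<⇒≤ p) | ≡ᵇ-false {i} {j} (λ e → <-irrefl (sym e) p) = refl

↑-↑ : ∀ {c d} M → d ≤ c → ↑ (suc c) (↑ d M) ≡ ↑ d (↑ c M)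
↑-↑ (free x L) p = refl
↑-↑ {c} {d} (bound v) p with v <? d
... | yes v<d rewrite ↑-below {v} {c} (≤-trans v<d p) | ↑-below {v} {d} v<d
                    | ↑-below {v} {suc c} (≤-trans v<d (m≤n⇒m≤1+n p)) = refl
... | no v≮d with v <? c
...   | yes v<c rewrite ↑-below {v} {c} v<c | ↑-above {v} {d} (≮⇒≥ v≮d)
                      | ↑-below {suc v} {suc c} (s≤s v<c) = refl
...   | no v≮c rewrite ↑-above {v} {c} (≮⇒≥ v≮c) | ↑-above {v} {d} (≮⇒≥ v≮d)
                     | ↑-above {suc v} {suc c} (s≤s (≮⇒≥ v≮c))
                     | ↑-above {suc v} {d} (≤-trans (≮⇒≥ v≮d) (n≤1+n v)) = refl
↑-↑ (M · N) p = cong₂ _·_ (↑-↑ M p) (↑-↑ N p)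
↑-↑ (ƛ L M) p = cong (ƛ L) (↑-↑ M (s≤s p))

↑-sub-j≤c : ∀ {c j} N M → j ≤ c → ↑ c (sub j N M) ≡ sub j (↑ c N) (↑ (suc c) M)
↑-sub-j≤c N (free x L) p = refl
↑-sub-j≤c {c} {j} N (bound v) p with <-cmp v j
... | tri< v<j _ _ rewrite sub-below {v} {j} {N} v<j | ↑-below {v} {c} (≤-trans v<j p)
                         | ↑-below {v} {suc c} (≤-trans v<j (m≤n⇒m≤1+n p))
                         | sub-below {v} {j} {↑ c N} v<j = refl
... | tri≈ _ refl _ rewrite sub-at {v} {N} | ↑-below {v} {suc c} (s≤s p) | sub-at {v} {↑ c N} = refl
↑-sub-j≤c {c} {j} N (bound zero) p | tri> _ _ ()
↑-sub-j≤c {c} {j} N (bound (suc w)) p | tri> _ _ j<v with w <? c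
... | yes w<c rewrite sub-above {suc w} {j} {N} j<v | ↑-below {w} {c} w<c
                    | ↑-below {suc w} {suc c} (s≤s w<c) | sub-above {suc w} {j} {↑ c N} j<v = refl
... | no w≮c rewrite sub-above {suc w} {j} {N} j<v | ↑-above {w} {c} (≮⇒≥ w≮c)
                   | ↑-above {suc w} {suc c} (s≤s (≮⇒≥ w≮c))
                   | sub-above {suc (suc w)} {j} {↑ c N} (m≤n⇒m≤1+n j<v) = refl
↑-sub-j≤c N (M₁ · M₂) p = cong₂ _·_ (↑-sub-j≤c N M₁ p) (↑-sub-j≤c N M₂ p)
↑-sub-j≤c {c} {j} N (ƛ L M) p rewrite ↑-sub-j≤c (↑ 0 N) M (s≤s p) | ↑-↑ {c} {0} N z≤n = refl

↑-sub-c≤j : ∀ {c j} N M → c ≤ j → ↑ c (sub j N M) ≡ sub (suc j) (↑ c N) (↑ c M)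
↑-sub-c≤j N (free x L) p = refl
↑-sub-c≤j {c} {j} N (bound v) p with <-cmp v j
↑-sub-c≤j {c} {j} N (bound v) p | tri< v<j _ _ with v <? c
... | yes v<c rewrite sub-below {v} {j} {N} v<j | ↑-below {v} {c} v<c
                    | sub-below {v} {suc j} {↑ c N} (m≤n⇒m≤1+n v<j) = refl
... | no v≮c rewrite sub-below {v} {j} {N} v<j | ↑-above {v} {c} (≮⇒≥ v≮c)
                   | sub-below {suc v} {suc j} {↑ c N} (s≤s v<j) = refl
↑-sub-c≤j {c} {j} N (bound v) p | tri≈ _ refl _
  rewrite sub-at {v} {N} | ↑-above {v} {c} p | sub-at {suc v} {↑ c N} = refl
↑-sub-c≤j {c} {j} N (bound zero) p | tri> _ _ ()
↑-sub-c≤j {c} {j} N (bound (suc w)) p | tri> _ _ (s≤s j≤w)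
  rewrite sub-above {suc w} {j} {N} (s≤s j≤w) | ↑-above {w} {c} (≤-trans p j≤w)
        | ↑-above {suc w} {c} (≤-trans p (m≤n⇒m≤1+n j≤w))
        | sub-above {suc (suc w)} {suc j} {↑ c N} (s≤s (s≤s j≤w)) = refl
↑-sub-c≤j N (M₁ · M₂) p = cong₂ _·_ (↑-sub-c≤j N M₁ p) (↑-sub-c≤j N M₂ p)
↑-sub-c≤j {c} {j} N (ƛ L M) p rewrite ↑-sub-c≤j (↑ 0 N) M (s≤s p) | ↑-↑ {c} {0} N z≤n = refl

sub-↑ : ∀ {c} N M → sub c N (↑ c M) ≡ M
sub-↑ N (free x L) = refl
sub-↑ {c} N (bound v) with v <? c
... | yes v<c rewrite ↑-below {v} {c} v<c | sub-below {v} {c} {N} v<c = refl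
... | no v≮c rewrite ↑-above {v} {c} (≮⇒≥ v≮c) | sub-above {suc v} {c} {N} (s≤s (≮⇒≥ v≮c)) = refl
sub-↑ N (M₁ · M₂) = cong₂ _·_ (sub-↑ N M₁) (sub-↑ N M₂)
sub-↑ N (ƛ L M) = cong (ƛ L) (sub-↑ (↑ 0 N) M)

sub-sub : ∀ {i k} N P Q → i ≤ k →
          sub k N (sub i P Q) ≡ sub i (sub k N P) (sub (suc k) (↑ i N) Q)
sub-sub N P (free x L) p = refl
sub-sub {i} {k} N P (bound v) p with <-cmp v i
sub-sub {i} {k} N P (bound v) p | tri< v<i _ _
  rewrite sub-below {v} {i} {P} v<i | sub-below {v} {k} {N} (≤-trans v<i p)
        | sub-below {v} {suc k} {↑ i N} (≤-trans v<i (m≤n⇒m≤1+n p))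
        | sub-below {v} {i} {sub k N P} v<i = refl
sub-sub {i} {k} N P (bound v) p | tri≈ _ refl _
  rewrite sub-at {v} {P} | sub-below {v} {suc k} {↑ v N} (s≤s p) | sub-at {v} {sub k N P} = refl
sub-sub {i} {k} N P (bound zero) p | tri> _ _ ()
sub-sub {i} {k} N P (bound (suc w)) p | tri> _ _ (s≤s i≤w) with <-cmp w k
... | tri< w<k _ _ rewrite sub-above {suc w} {i} {P} (s≤s i≤w) | sub-below {w} {k} {N} w<k
                         | sub-below {suc w} {suc k} {↑ i N} (s≤s w<k)
                         | sub-above {suc w} {i} {sub k N P} (s≤s i≤w) = refl
... | tri≈ _ refl _ rewrite sub-above {suc w} {i} {P} (s≤s i≤w) | sub-at {w} {N}
                          | sub-at {suc w} {↑ i N} | sub-↑ {i} (sub w N P) N = refl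
... | tri> _ _ k<w rewrite sub-above {suc w} {i} {P} (s≤s i≤w) | sub-above {w} {k} {N} k<w
                         | sub-above {suc w} {suc k} {↑ i N} (s≤s k<w)
                         | sub-above {w} {i} {sub k N P} (≤-trans (s≤s p) k<w) = refl
sub-sub N P (Q₁ · Q₂) p = cong₂ _·_ (sub-sub N P Q₁ p) (sub-sub N P Q₂ p)
sub-sub {i} {k} N P (ƛ L Q) p
  rewrite sub-sub (↑ 0 N) (↑ 0 P) Q (s≤s p) | ↑-sub-c≤j {0} {k} N P z≤n | ↑-↑ {i} {0} N z≤n = refl

-- Substituting a bound variable back for itself: the β-contractum of an
-- η-redex body is the original term.
sub-bound-↑ : ∀ {c} Q → sub c (bound c) (↑ (suc c) Q) ≡ Q
sub-bound-↑ (free x L) = refl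
sub-bound-↑ {c} (bound v) with <-cmp v c
... | tri< v<c _ _ rewrite ↑-below {v} {suc c} (m≤n⇒m≤1+n v<c) | sub-below {v} {c} {bound c} v<c = refl
... | tri≈ _ refl _ rewrite ↑-below {v} {suc v} ≤-refl | sub-at {v} {bound v} = refl
... | tri> _ _ c<v rewrite ↑-above {v} {suc c} c<v | sub-above {suc v} {c} {bound c} (m≤n⇒m≤1+n c<v) = refl
sub-bound-↑ (Q₁ · Q₂) = cong₂ _·_ (sub-bound-↑ Q₁) (sub-bound-↑ Q₂)
sub-bound-↑ (ƛ L Q) = cong (ƛ L) (sub-bound-↑ Q)

-- Degrees d(M) of raw expressions, relative to the enclosing binders.

-- The index of the i-th enclosing binder (arbitrary when out of range).
look : Ctx → ℕ → Index
look [] _ = []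
look (L ∷ Γ) zero = L
look (L ∷ Γ) (suc i) = look Γ i

-- The degree d(M) computed syntactically: the index of the head variable.
deg : Ctx → Tm → Index
deg Γ (free x L) = L
deg Γ (bound i) = look Γ i
deg Γ (M · N) = deg Γ M
deg Γ (ƛ L M) = deg (L ∷ Γ) M

look-below : ∀ Δ {L Γ v} → v < length Δ → look (Δ ++ L ∷ Γ) v ≡ look (Δ ++ Γ) v
look-below (K ∷ Δ) {v = zero} p = refl
look-below (K ∷ Δ) {v = suc v} (s≤s p) = look-below Δ p

look-at : ∀ Δ {L Γ} → look (Δ ++ L ∷ Γ) (length Δ) ≡ L
look-at [] = refl
look-at (K ∷ Δ) = look-at Δ

look-above : ∀ Δ {L Γ v} → length Δ < v → look (Δ ++ L ∷ Γ) v ≡ look (Δ ++ Γ) (pred v)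
look-above [] {v = suc v} p = refl
look-above (K ∷ Δ) {v = suc (suc v)} (s≤s p) = look-above Δ p

deg-↑ : ∀ Δ {L Γ} M → deg (Δ ++ L ∷ Γ) (↑ (length Δ) M) ≡ deg (Δ ++ Γ) M
deg-↑ Δ (free x L) = refl
deg-↑ Δ (bound v) with v <? length Δ
... | yes p rewrite ↑-below {v} {length Δ} p = look-below Δ p
... | no p rewrite ↑-above {v} {length Δ} (≮⇒≥ p) = look-above Δ (s≤s (≮⇒≥ p))
deg-↑ Δ (M · N) = deg-↑ Δ M
deg-↑ Δ (ƛ K M) = deg-↑ (K ∷ Δ) M

deg-sub : ∀ Δ {L Γ N} M → deg (Δ ++ Γ) N ≡ L →
          deg (Δ ++ Γ) (sub (length Δ) N M) ≡ deg (Δ ++ L ∷ Γ) M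
deg-sub Δ (free x L) d = refl
deg-sub Δ {N = N} (bound v) d with <-cmp v (length Δ)
... | tri< p _ _ rewrite sub-below {v} {length Δ} {N} p = sym (look-below Δ p)
... | tri≈ _ refl _ rewrite sub-at {v} {N} = trans d (sym (look-at Δ))
... | tri> _ _ p rewrite sub-above {v} {length Δ} {N} p = sym (look-above Δ p)
deg-sub Δ (M · M₁) d = deg-sub Δ M d
deg-sub Δ {N = N} (ƛ K M) d = deg-sub (K ∷ Δ) M (trans (deg-↑ [] N) d)

-- Raw β-reduction is confluent, by the method of Tait and Martin-Löf.

-- Compatible closure of β on raw expressions under binders Γ; the only
-- side condition kept is that the argument has the binder's degree.
data Beta (Γ : Ctx) : Tm → Tm → Set where
  β-contract : ∀ {L M N} → deg Γ N ≡ L → Beta Γ (ƛ L M · N) (sub 0 N M)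
  β-appˡ     : ∀ {M M′ N} → Beta Γ M M′ → Beta Γ (M · N) (M′ · N)
  β-appʳ     : ∀ {M N N′} → Beta Γ N N′ → Beta Γ (M · N) (M · N′)
  β-lam      : ∀ {L M M′} → Beta (L ∷ Γ) M M′ → Beta Γ (ƛ L M) (ƛ L M′)

data Par (Γ : Ctx) : Tm → Tm → Set where
  par-free  : ∀ {x L} → Par Γ (free x L) (free x L)
  par-bound : ∀ {i} → Par Γ (bound i) (bound i)
  par-app   : ∀ {M M′ N N′} → Par Γ M M′ → Par Γ N N′ → Par Γ (M · N) (M′ · N′)
  par-lam   : ∀ {L M M′} → Par (L ∷ Γ) M M′ → Par Γ (ƛ L M) (ƛ L M′)
  par-β     : ∀ {L M M′ N N′} → Par (L ∷ Γ) M M′ → Par Γ N N′ → deg Γ N ≡ L →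
              Par Γ (ƛ L M · N) (sub 0 N′ M′)

par-refl : ∀ {Γ} M → Par Γ M M
par-refl (free x L) = par-free
par-refl (bound i) = par-bound
par-refl (M · N) = par-app (par-refl M) (par-refl N)
par-refl (ƛ L M) = par-lam (par-refl M)

par-deg : ∀ {Γ M M′} → Par Γ M M′ → deg Γ M ≡ deg Γ M′
par-deg par-free = refl
par-deg par-bound = refl
par-deg (par-app p q) = par-deg p
par-deg (par-lam p) = par-deg p
par-deg (par-β {M′ = M′} p q d) = trans (par-deg p) (sym (deg-sub [] M′ (trans (sym (par-deg q)) d)))

par-↑ : ∀ Δ {L Γ M M′} → Par (Δ ++ Γ) M M′ → Par (Δ ++ L ∷ Γ) (↑ (length Δ) M) (↑ (length Δ) M′)
par-↑ Δ par-free = par-free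
par-↑ Δ (par-bound {i}) = par-refl (↑ (length Δ) (bound i))
par-↑ Δ (par-app p q) = par-app (par-↑ Δ p) (par-↑ Δ q)
par-↑ Δ (par-lam {L} p) = par-lam (par-↑ (L ∷ Δ) p)
par-↑ Δ (par-β {K} {M} {M′} {N} {N′} p q d) rewrite ↑-sub-j≤c {length Δ} {0} N′ M′ z≤n =
  par-β (par-↑ (K ∷ Δ) p) (par-↑ Δ q) (trans (deg-↑ Δ N) d)

par-sub : ∀ Δ {L Γ M M′ N N′} → Par (Δ ++ L ∷ Γ) M M′ → Par (Δ ++ Γ) N N′ → deg (Δ ++ Γ) N ≡ L →
          Par (Δ ++ Γ) (sub (length Δ) N M) (sub (length Δ) N′ M′)
par-sub Δ par-free q d = par-free
par-sub Δ {N = N} {N′} (par-bound {v}) q d with <-cmp v (length Δ)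
... | tri< p _ _ rewrite sub-below {v} {length Δ} {N} p | sub-below {v} {length Δ} {N′} p = par-bound
... | tri≈ _ refl _ rewrite sub-at {v} {N} | sub-at {v} {N′} = q
... | tri> _ _ p rewrite sub-above {v} {length Δ} {N} p | sub-above {v} {length Δ} {N′} p = par-bound
par-sub Δ (par-app p p′) q d = par-app (par-sub Δ p q d) (par-sub Δ p′ q d)
par-sub Δ {N = N} (par-lam {K} p) q d =
  par-lam (par-sub (K ∷ Δ) p (par-↑ [] q) (trans (deg-↑ [] N) d))
par-sub Δ {N = N} {N′} (par-β {K} {P} {P′} {Q} {Q′} p p′ e) q d
  rewrite sub-sub {0} {length Δ} N′ Q′ P′ z≤n =
  par-β (par-sub (K ∷ Δ) p (par-↑ [] q) (trans (deg-↑ [] N) d)) (par-sub Δ p′ q d)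
        (trans (deg-sub Δ Q d) e)

_≟ᴵ_ : (K L : Index) → Dec (K ≡ L)
_≟ᴵ_ = ≡-dec _≟_

mutual
  develop : Ctx → Tm → Tm
  develop Γ (free x L) = free x L
  develop Γ (bound i) = bound i
  develop Γ (M · N) = develop-app Γ M N
  develop Γ (ƛ L M) = ƛ L (develop (L ∷ Γ) M)

  develop-app : Ctx → Tm → Tm → Tm
  develop-app Γ (ƛ L M) N with deg Γ N ≟ᴵ L
  ... | yes _ = sub 0 (develop Γ N) (develop (L ∷ Γ) M)
  ... | no _ = ƛ L (develop (L ∷ Γ) M) · develop Γ N
  develop-app Γ (free x L) N = free x L · develop Γ N
  develop-app Γ (bound i) N = bound i · develop Γ N
  develop-app Γ (M · M′) N = develop-app Γ M M′ · develop Γ N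

triangle : ∀ {Γ M M′} → Par Γ M M′ → Par Γ M′ (develop Γ M)
triangle par-free = par-free
triangle par-bound = par-bound
triangle (par-lam p) = par-lam (triangle p)
triangle {Γ} (par-app {ƛ L P} {N = N} (par-lam p) q) with deg Γ N ≟ᴵ L
... | yes d = par-β (triangle p) (triangle q) (trans (sym (par-deg q)) d)
... | no _ = par-app (par-lam (triangle p)) (triangle q)
triangle (par-app {free x L} p q) = par-app (triangle p) (triangle q)
triangle (par-app {bound i} p q) = par-app (triangle p) (triangle q)
triangle (par-app {M · M₁} p q) = par-app (triangle p) (triangle q)
triangle {Γ} (par-β {L} {N = N} p q d) with deg Γ N ≟ᴵ L
... | yes _ = par-sub [] (triangle p) (triangle q) (trans (sym (par-deg q)) d)
... | no ¬d = ⊥-elim (¬d d)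

par-diamond : ∀ {Γ} → Diamond (Par Γ)
par-diamond {Γ} {a} p q = develop Γ a , triangle p , triangle q

beta⇒par : ∀ {Γ} → Beta Γ ⇒ Par Γ
beta⇒par (β-contract d) = par-β (par-refl _) (par-refl _) d
beta⇒par (β-appˡ s) = par-app (beta⇒par s) (par-refl _)
beta⇒par (β-appʳ s) = par-app (par-refl _) (beta⇒par s)
beta⇒par (β-lam s) = par-lam (beta⇒par s)

par⇒beta* : ∀ {Γ} → Par Γ ⇒ Star (Beta Γ)
par⇒beta* par-free = ε
par⇒beta* par-bound = ε
par⇒beta* (par-app {M} {M′} {N} {N′} p q) =
  Star.gmap (_· N) β-appˡ (par⇒beta* p) ◅◅ Star.gmap (M′ ·_) β-appʳ (par⇒beta* q)
par⇒beta* (par-lam {L} p) = Star.gmap (ƛ L) β-lam (par⇒beta* p)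
par⇒beta* (par-β {L} {M} {M′} {N} {N′} p q d) =
  Star.gmap (_· N) β-appˡ (Star.gmap (ƛ L) β-lam (par⇒beta* p)) ◅◅
  Star.gmap (ƛ L M′ ·_) β-appʳ (par⇒beta* q) ◅◅
  β-contract (trans (sym (par-deg q)) d) ◅ ε

-- Raw β is confluent: parallel reduction lies between it and its closure.
beta-confluent : ∀ {Γ} → Confluent (Beta Γ)
beta-confluent = diamond-between beta⇒par par⇒beta* par-diamond

-- Inverting shifts: the parts of a shifted expression are shifts; this is
-- how η-redexes, whose bodies are shifts, are analysed.

shift-var : ℕ → ℕ → ℕ
shift-var zero v = suc v
shift-var (suc c) zero = zero
shift-var (suc c) (suc v) = suc (shift-var c v)

shift-var-below : ∀ {c v} → v < c → shift-var c v ≡ v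
shift-var-below {suc c} {zero} _ = refl
shift-var-below {suc c} {suc v} (s≤s p) = cong suc (shift-var-below p)

shift-var-above : ∀ {c v} → c ≤ v → shift-var c v ≡ suc v
shift-var-above {zero} _ = refl
shift-var-above {suc c} {suc v} (s≤s p) = cong suc (shift-var-above p)

↑-bound : ∀ {c v} → ↑ c (bound v) ≡ bound (shift-var c v)
↑-bound {c} {v} with v <? c
... | yes p rewrite ↑-below p | shift-var-below p = refl
... | no p rewrite ↑-above (≮⇒≥ p) | shift-var-above (≮⇒≥ p) = refl

shift-var-shift-var⁻¹ : ∀ {c d a x} → d ≤ c → shift-var (suc c) a ≡ shift-var d x →
                        ∃ λ y → a ≡ shift-var d y × x ≡ shift-var c y
shift-var-shift-var⁻¹ {c} {zero} {zero} p ()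
shift-var-shift-var⁻¹ {c} {zero} {suc a} p refl = a , refl , refl
shift-var-shift-var⁻¹ {suc c} {suc d} {zero} {zero} (s≤s p) e = zero , refl , refl
shift-var-shift-var⁻¹ {suc c} {suc d} {suc a} {zero} (s≤s p) ()
shift-var-shift-var⁻¹ {suc c} {suc d} {suc a} {suc x} (s≤s p) e
  with shift-var-shift-var⁻¹ {c} {d} {a} {x} p (suc-injective e)
... | y , refl , refl = suc y , refl , refl

↑-free⁻¹ : ∀ {c A x L} → ↑ c A ≡ free x L → A ≡ free x L
↑-free⁻¹ {A = free y K} e = e
↑-free⁻¹ {c} {A = bound v} e rewrite ↑-bound {c} {v} with e
... | ()

↑-bound⁻¹ : ∀ {c A w} → ↑ c A ≡ bound w → ∃ λ a → A ≡ bound a × shift-var c a ≡ w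
↑-bound⁻¹ {c} {A = bound v} e rewrite ↑-bound {c} {v} with e
... | refl = v , refl , refl

↑-app⁻¹ : ∀ {c A P Q} → ↑ c A ≡ P · Q → ∃ λ A₁ → ∃ λ A₂ → A ≡ A₁ · A₂ × ↑ c A₁ ≡ P × ↑ c A₂ ≡ Q
↑-app⁻¹ {c} {A = bound v} e rewrite ↑-bound {c} {v} with e
... | ()
↑-app⁻¹ {A = A₁ · A₂} refl = A₁ , A₂ , refl , refl , refl

↑-lam⁻¹ : ∀ {c A L Q} → ↑ c A ≡ ƛ L Q → ∃ λ A₁ → A ≡ ƛ L A₁ × ↑ (suc c) A₁ ≡ Q
↑-lam⁻¹ {c} {A = bound v} e rewrite ↑-bound {c} {v} with e
... | ()
↑-lam⁻¹ {A = ƛ K A} refl = A , refl , refl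

↑-injective : ∀ {c X Y} → ↑ c X ≡ ↑ c Y → X ≡ Y
↑-injective {c} {X} {Y} e =
  trans (sym (sub-↑ {c} (bound 0) X)) (trans (cong (sub c (bound 0)) e) (sub-↑ {c} (bound 0) Y))

↑-↑⁻¹ : ∀ {c d} A X → d ≤ c → ↑ (suc c) A ≡ ↑ d X → ∃ λ Y → A ≡ ↑ d Y × X ≡ ↑ c Y
↑-↑⁻¹ {c} A (free x L) p e with ↑-free⁻¹ {suc c} {A} e
... | refl = free x L , refl , refl
↑-↑⁻¹ {c} {d} A (bound x) p e rewrite ↑-bound {d} {x} with ↑-bound⁻¹ {suc c} {A} e
... | a , refl , e′ with shift-var-shift-var⁻¹ {c} {d} {a} {x} p e′
...   | y , refl , refl = bound y , sym (↑-bound {d} {y}) , sym (↑-bound {c} {y})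
↑-↑⁻¹ {c} A (X₁ · X₂) p e with ↑-app⁻¹ {suc c} {A} e
... | A₁ , A₂ , refl , e₁ , e₂ with ↑-↑⁻¹ A₁ X₁ p e₁ | ↑-↑⁻¹ A₂ X₂ p e₂
...   | Y₁ , refl , refl | Y₂ , refl , refl = Y₁ · Y₂ , refl , refl
↑-↑⁻¹ {c} A (ƛ L X) p e with ↑-lam⁻¹ {suc c} {A} e
... | A₁ , refl , e₁ with ↑-↑⁻¹ A₁ X (s≤s p) e₁
...   | Y , refl , refl = ƛ L Y , refl , refl

-- Raw η-reduction; raw βη-reduction is confluent by Hindley–Rosen.

data Eta : Tm → Tm → Set where
  η-contract : ∀ {L M P} → P ≡ ↑ 0 M → Eta (ƛ L (P · bound 0)) M
  η-appˡ     : ∀ {M M′ N} → Eta M M′ → Eta (M · N) (M′ · N)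
  η-appʳ     : ∀ {M N N′} → Eta N N′ → Eta (M · N) (M · N′)
  η-lam      : ∀ {L M M′} → Eta M M′ → Eta (ƛ L M) (ƛ L M′)

eta-↑ : ∀ {c M M′} → Eta M M′ → Eta (↑ c M) (↑ c M′)
eta-↑ {c} (η-contract {M = M} refl) = η-contract (↑-↑ {c} {0} M z≤n)
eta-↑ (η-appˡ s) = η-appˡ (eta-↑ s)
eta-↑ (η-appʳ s) = η-appʳ (eta-↑ s)
eta-↑ (η-lam s) = η-lam (eta-↑ s)

eta-↑⁻¹ : ∀ {c Q P} → Eta Q P → ∀ {M} → Q ≡ ↑ c M → ∃ λ M′ → P ≡ ↑ c M′ × Eta M M′
eta-↑⁻¹ {c} (η-contract {M = X} e) {M} eq with ↑-lam⁻¹ {c} {M} (sym eq)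
... | A₁ , refl , e₁ with ↑-app⁻¹ {suc c} {A₁} e₁
...   | B₁ , B₂ , refl , f₁ , f₂ with ↑-bound⁻¹ {suc c} {B₂} f₂
...     | zero , refl , _ with ↑-↑⁻¹ B₁ X z≤n (trans f₁ e)
...       | Y , refl , refl = Y , refl , η-contract refl
eta-↑⁻¹ {c} (η-appˡ s) {M} eq with ↑-app⁻¹ {c} {M} (sym eq)
... | A₁ , A₂ , refl , refl , refl with eta-↑⁻¹ {c} s refl
...   | M′ , refl , s′ = M′ · A₂ , refl , η-appˡ s′
eta-↑⁻¹ {c} (η-appʳ s) {M} eq with ↑-app⁻¹ {c} {M} (sym eq)
... | A₁ , A₂ , refl , refl , refl with eta-↑⁻¹ {c} s refl
...   | M′ , refl , s′ = A₁ · M′ , refl , η-appʳ s′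
eta-↑⁻¹ {c} (η-lam s) {M} eq with ↑-lam⁻¹ {c} {M} (sym eq)
... | A₁ , refl , refl with eta-↑⁻¹ {suc c} s refl
...   | M′ , refl , s′ = ƛ _ M′ , refl , η-lam s′

beta-↑⁻¹ : ∀ Δ {L Γ Q P} → Beta (Δ ++ L ∷ Γ) Q P → ∀ {M} → Q ≡ ↑ (length Δ) M →
           ∃ λ M′ → P ≡ ↑ (length Δ) M′ × Beta (Δ ++ Γ) M M′
beta-↑⁻¹ Δ (β-contract d) {M} eq with ↑-app⁻¹ {length Δ} {M} (sym eq)
... | A₁ , A₂ , refl , e₁ , refl with ↑-lam⁻¹ {length Δ} {A₁} e₁
...   | R₀ , refl , refl =
  sub 0 A₂ R₀ , sym (↑-sub-j≤c {length Δ} {0} A₂ R₀ z≤n) , β-contract (trans (sym (deg-↑ Δ A₂)) d)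
beta-↑⁻¹ Δ (β-appˡ s) {M} eq with ↑-app⁻¹ {length Δ} {M} (sym eq)
... | A₁ , A₂ , refl , refl , refl with beta-↑⁻¹ Δ s refl
...   | M′ , refl , s′ = M′ · A₂ , refl , β-appˡ s′
beta-↑⁻¹ Δ (β-appʳ s) {M} eq with ↑-app⁻¹ {length Δ} {M} (sym eq)
... | A₁ , A₂ , refl , refl , refl with beta-↑⁻¹ Δ s refl
...   | M′ , refl , s′ = A₁ · M′ , refl , β-appʳ s′
beta-↑⁻¹ Δ (β-lam {K} s) {M} eq with ↑-lam⁻¹ {length Δ} {M} (sym eq)
... | A₁ , refl , refl with beta-↑⁻¹ (K ∷ Δ) s refl
...   | M′ , refl , s′ = ƛ K M′ , refl , β-lam s′

eta-deg : ∀ {Γ M M′} → Eta M M′ → deg Γ M ≡ deg Γ M′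
eta-deg (η-contract {M = M} refl) = deg-↑ [] M
eta-deg (η-appˡ s) = eta-deg s
eta-deg (η-appʳ s) = refl
eta-deg (η-lam s) = eta-deg s

eta-sub-body : ∀ {c N M M′} → Eta M M′ → Eta (sub c N M) (sub c N M′)
eta-sub-body {c} {N} (η-contract {M = M} refl) = η-contract (sym (↑-sub-c≤j {0} {c} N M z≤n))
eta-sub-body (η-appˡ s) = η-appˡ (eta-sub-body s)
eta-sub-body (η-appʳ s) = η-appʳ (eta-sub-body s)
eta-sub-body (η-lam s) = η-lam (eta-sub-body s)

-- η in the substituted argument: one step for each copy of the argument.
eta-sub-arg : ∀ {c N N′} M → Eta N N′ → Star Eta (sub c N M) (sub c N′ M)
eta-sub-arg (free x L) s = ε
eta-sub-arg {c} {N} {N′} (bound v) s with <-cmp v c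
... | tri< p _ _ rewrite sub-below {v} {c} {N} p | sub-below {v} {c} {N′} p = ε
... | tri≈ _ refl _ rewrite sub-at {v} {N} | sub-at {v} {N′} = s ◅ ε
... | tri> _ _ p rewrite sub-above {v} {c} {N} p | sub-above {v} {c} {N′} p = ε
eta-sub-arg {c} {N} {N′} (M₁ · M₂) s =
  Star.gmap (_· sub c N M₂) η-appˡ (eta-sub-arg M₁ s) ◅◅
  Star.gmap (sub c N′ M₁ ·_) η-appʳ (eta-sub-arg M₂ s)
eta-sub-arg (ƛ L M) s = Star.gmap (ƛ L) η-lam (eta-sub-arg M (eta-↑ s))

-- Overlapping η-steps: the only critical pair is λx.(λy.(M′ y)) x, whose
-- two contracta coincide up to one further η-step.
eta-subcommutative : Subcommutative Eta
eta-subcommutative (η-contract e₁) (η-contract e₂) = inj₁ (↑-injective (trans (sym e₁) e₂))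
eta-subcommutative (η-contract e) (η-lam (η-appˡ s)) with eta-↑⁻¹ s e
... | X′ , e′ , s′ = inj₂ (X′ , s′ , η-contract e′)
eta-subcommutative (η-lam (η-appˡ s)) (η-contract e) with eta-↑⁻¹ s e
... | X′ , e′ , s′ = inj₂ (X′ , η-contract e′ , s′)
eta-subcommutative (η-appˡ s₁) (η-appˡ s₂) with eta-subcommutative s₁ s₂
... | inj₁ refl = inj₁ refl
... | inj₂ (d , p , q) = inj₂ (_ , η-appˡ p , η-appˡ q)
eta-subcommutative (η-appˡ s₁) (η-appʳ s₂) = inj₂ (_ , η-appʳ s₂ , η-appˡ s₁)
eta-subcommutative (η-appʳ s₁) (η-appˡ s₂) = inj₂ (_ , η-appˡ s₂ , η-appʳ s₁)
eta-subcommutative (η-appʳ s₁) (η-appʳ s₂) with eta-subcommutative s₁ s₂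
... | inj₁ refl = inj₁ refl
... | inj₂ (d , p , q) = inj₂ (_ , η-appʳ p , η-appʳ q)
eta-subcommutative (η-lam s₁) (η-lam s₂) with eta-subcommutative s₁ s₂
... | inj₁ refl = inj₁ refl
... | inj₂ (d , p , q) = inj₂ (_ , η-lam p , η-lam q)

eta-beta-commute : ∀ {Γ} → StronglyCommute Eta (Beta Γ)
eta-beta-commute (η-contract {M = X} e) (β-lam (β-contract refl)) with ↑-lam⁻¹ {0} {X} (sym e)
... | R₀ , refl , refl rewrite sub-bound-↑ {0} R₀ = _ , stay , ε
eta-beta-commute (η-contract e) (β-lam (β-appˡ s)) with beta-↑⁻¹ [] s e
... | X′ , e′ , s′ = X′ , [ s′ ] , η-contract e′ ◅ ε
eta-beta-commute (η-appˡ (η-contract {M = X} refl)) (β-contract {N = N} d)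
  rewrite sub-↑ {0} N X = _ , stay , ε
eta-beta-commute (η-appˡ (η-lam s)) (β-contract d) = _ , [ β-contract d ] , eta-sub-body s ◅ ε
eta-beta-commute (η-appʳ {M = ƛ L A} s) (β-contract d) =
  _ , [ β-contract (trans (sym (eta-deg s)) d) ] , eta-sub-arg A s
eta-beta-commute (η-appˡ s₁) (β-appˡ s₂) with eta-beta-commute s₁ s₂
... | d , p , q = _ , Refl.map β-appˡ p , Star.gmap _ η-appˡ q
eta-beta-commute (η-appˡ s₁) (β-appʳ s₂) = _ , [ β-appʳ s₂ ] , η-appˡ s₁ ◅ ε
eta-beta-commute (η-appʳ s₁) (β-appˡ s₂) = _ , [ β-appˡ s₂ ] , η-appʳ s₁ ◅ ε
eta-beta-commute (η-appʳ s₁) (β-appʳ s₂) with eta-beta-commute s₁ s₂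
... | d , p , q = _ , Refl.map β-appʳ p , Star.gmap _ η-appʳ q
eta-beta-commute (η-lam s₁) (β-lam s₂) with eta-beta-commute s₁ s₂
... | d , p , q = _ , Refl.map β-lam p , Star.gmap _ η-lam q

beta-eta-confluent : ∀ {Γ} → Confluent (Beta Γ ∪ Eta)
beta-eta-confluent =
  hindley-rosen beta-confluent (subcommutative⇒confluent eta-subcommutative)
                (commute-star eta-beta-commute)

-- Subject reduction: raw steps preserve well-formedness, because they
-- preserve degrees and do not create free variables.

∋-↑ : ∀ Δ {L Γ v K} → (Δ ++ Γ) ∋ v ∶ K → (Δ ++ L ∷ Γ) ∋ shift-var (length Δ) v ∶ K
∋-↑ [] p = there p
∋-↑ (J ∷ Δ) here = here
∋-↑ (J ∷ Δ) (there p) = there (∋-↑ Δ p)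

∋-↑⁻¹ : ∀ Δ {L Γ v K} → (Δ ++ L ∷ Γ) ∋ shift-var (length Δ) v ∶ K → (Δ ++ Γ) ∋ v ∶ K
∋-↑⁻¹ [] (there p) = p
∋-↑⁻¹ (J ∷ Δ) {v = zero} here = here
∋-↑⁻¹ (J ∷ Δ) {v = suc v} (there p) = there (∋-↑⁻¹ Δ p)

∋-below : ∀ Δ {L Γ v K} → v < length Δ → (Δ ++ L ∷ Γ) ∋ v ∶ K → (Δ ++ Γ) ∋ v ∶ K
∋-below (J ∷ Δ) q here = here
∋-below (J ∷ Δ) (s≤s q) (there p) = there (∋-below Δ q p)

∋-at : ∀ Δ {L Γ K} → (Δ ++ L ∷ Γ) ∋ length Δ ∶ K → K ≡ L
∋-at [] here = refl
∋-at (J ∷ Δ) (there p) = ∋-at Δ p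

∋-above : ∀ Δ {L Γ v K} → length Δ < v → (Δ ++ L ∷ Γ) ∋ v ∶ K → (Δ ++ Γ) ∋ pred v ∶ K
∋-above [] q (there p) = p
∋-above (J ∷ Δ) (s≤s q) (there {i = suc i} p) = there (∋-above Δ q p)

∋-look : ∀ {Γ v K} → Γ ∋ v ∶ K → look Γ v ≡ K
∋-look here = refl
∋-look (there p) = ∋-look p

wf-deg : ∀ {Γ M K} → WF Γ M K → deg Γ M ≡ K
wf-deg wf-free = refl
wf-deg (wf-bound p) = ∋-look p
wf-deg (wf-app w w′ _ _) = wf-deg w
wf-deg (wf-lam w _) = wf-deg w

fv-↑ : ∀ {c} M → fv (↑ c M) ≡ fv M
fv-↑ (free x L) = refl
fv-↑ {c} (bound v) rewrite ↑-bound {c} {v} = refl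
fv-↑ (M · N) = cong₂ _++_ (fv-↑ M) (fv-↑ N)
fv-↑ (ƛ L M) = fv-↑ M

fv-sub : ∀ {c N} M → fv (sub c N M) ⊆ fv M ++ fv N
fv-sub (free x L) p = ∈-++⁺ˡ p
fv-sub {c} {N} (bound v) p with <-cmp v c
... | tri< q _ _ rewrite sub-below {v} {c} {N} q with p
...   | ()
fv-sub {c} {N} (bound v) p | tri≈ _ refl _ rewrite sub-at {v} {N} = p
fv-sub {c} {N} (bound v) p | tri> _ _ q rewrite sub-above {v} {c} {N} q with p
...   | ()
fv-sub {c} {N} (M₁ · M₂) p with ∈-++⁻ (fv (sub c N M₁)) p
... | inj₁ q with ∈-++⁻ (fv M₁) (fv-sub M₁ q)
...   | inj₁ r = ∈-++⁺ˡ (∈-++⁺ˡ r)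
...   | inj₂ r = ∈-++⁺ʳ _ r
fv-sub {c} {N} (M₁ · M₂) p | inj₂ q with ∈-++⁻ (fv M₂) (fv-sub M₂ q)
...   | inj₁ r = ∈-++⁺ˡ (∈-++⁺ʳ (fv M₁) r)
...   | inj₂ r = ∈-++⁺ʳ _ r
fv-sub {c} {N} (ƛ L M) p rewrite sym (fv-↑ {0} N) = fv-sub M p

beta-fv : ∀ {Γ M M′} → Beta Γ M M′ → fv M′ ⊆ fv M
beta-fv (β-contract {M = M} d) = fv-sub M
beta-fv (β-appˡ s) = ++⁺ (beta-fv s) ⊆-refl
beta-fv (β-appʳ s) = ++⁺ ⊆-refl (beta-fv s)
beta-fv (β-lam s) = beta-fv s

eta-fv : ∀ {M M′} → Eta M M′ → fv M′ ⊆ fv M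
eta-fv (η-contract {M = M} refl) p rewrite fv-↑ {0} M = ∈-++⁺ˡ p
eta-fv (η-appˡ s) = ++⁺ (eta-fv s) ⊆-refl
eta-fv (η-appʳ s) = ++⁺ ⊆-refl (eta-fv s)
eta-fv (η-lam s) = eta-fv s

-- Joinability of two lists of indexed variables; M ⋄ N unfolds to fv M ⋈ fv N.
_⋈_ : List (ℕ × Index) → List (ℕ × Index) → Set
A ⋈ B = ∀ {x L K} → (x , L) ∈ A → (x , K) ∈ B → L ≡ K

⋈-mono : ∀ {A A′ B B′} → A′ ⊆ A → B′ ⊆ B → A ⋈ B → A′ ⋈ B′
⋈-mono f g j p q = j (f p) (g q)

wf-self : ∀ {Γ M K} → WF Γ M K → M ⋄ M
wf-self wf-free (Any.here refl) (Any.here refl) = refl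
wf-self (wf-app {M} w w′ _ j) p q with ∈-++⁻ (fv M) p | ∈-++⁻ (fv M) q
... | inj₁ p′ | inj₁ q′ = wf-self w p′ q′
... | inj₁ p′ | inj₂ q′ = j p′ q′
... | inj₂ p′ | inj₁ q′ = sym (j q′ p′)
... | inj₂ p′ | inj₂ q′ = wf-self w′ p′ q′
wf-self (wf-lam w _) p q = wf-self w p q

↑-⋄ : ∀ {c d} M N → M ⋄ N → ↑ c M ⋄ ↑ d N
↑-⋄ {c} {d} M N j rewrite fv-↑ {c} M | fv-↑ {d} N = j

↑-⋄⁻¹ : ∀ {c d} M N → ↑ c M ⋄ ↑ d N → M ⋄ N
↑-⋄⁻¹ {c} {d} M N j rewrite fv-↑ {c} M | fv-↑ {d} N = j

wf-↑ : ∀ Δ {L Γ M K} → WF (Δ ++ Γ) M K → WF (Δ ++ L ∷ Γ) (↑ (length Δ) M) K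
wf-↑ Δ wf-free = wf-free
wf-↑ Δ (wf-bound {i} p) rewrite ↑-bound {length Δ} {i} = wf-bound (∋-↑ Δ p)
wf-↑ Δ (wf-app {M} {N} w w′ q j) = wf-app (wf-↑ Δ w) (wf-↑ Δ w′) q (↑-⋄ M N j)
wf-↑ Δ (wf-lam {L = K} w q) = wf-lam (wf-↑ (K ∷ Δ) w) q

wf-↑⁻¹ : ∀ Δ {L Γ K} M → WF (Δ ++ L ∷ Γ) (↑ (length Δ) M) K → WF (Δ ++ Γ) M K
wf-↑⁻¹ Δ (free x L) wf-free = wf-free
wf-↑⁻¹ Δ (bound v) w rewrite ↑-bound {length Δ} {v} with w
... | wf-bound p = wf-bound (∋-↑⁻¹ Δ p)
wf-↑⁻¹ Δ (M · N) (wf-app w w′ q j) = wf-app (wf-↑⁻¹ Δ M w) (wf-↑⁻¹ Δ N w′) q (↑-⋄⁻¹ M N j)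
wf-↑⁻¹ Δ (ƛ K M) (wf-lam w q) = wf-lam (wf-↑⁻¹ (K ∷ Δ) M w) q

wf-sub : ∀ Δ {L Γ M N K} → WF (Δ ++ L ∷ Γ) M K → WF (Δ ++ Γ) N L → M ⋄ N → N ⋄ N →
         WF (Δ ++ Γ) (sub (length Δ) N M) K
wf-sub Δ wf-free wN j jN = wf-free
wf-sub Δ {N = N} (wf-bound {v} p) wN j jN with <-cmp v (length Δ)
... | tri< q _ _ rewrite sub-below {v} {length Δ} {N} q = wf-bound (∋-below Δ q p)
... | tri≈ _ refl _ rewrite sub-at {v} {N} | ∋-at Δ p = wN
... | tri> _ _ q rewrite sub-above {v} {length Δ} {N} q = wf-bound (∋-above Δ q p)
wf-sub Δ {N = N} (wf-app {M₁} {M₂} w w′ q j₁₂) wN j jN =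
  wf-app (wf-sub Δ w wN j₁ jN) (wf-sub Δ w′ wN j₂ jN) q jj
  where
  j₁ : M₁ ⋄ N
  j₁ p r = j (∈-++⁺ˡ p) r
  j₂ : M₂ ⋄ N
  j₂ p r = j (∈-++⁺ʳ (fv M₁) p) r
  jj : sub (length Δ) N M₁ ⋄ sub (length Δ) N M₂
  jj p r with ∈-++⁻ (fv M₁) (fv-sub M₁ p) | ∈-++⁻ (fv M₂) (fv-sub M₂ r)
  ... | inj₁ a | inj₁ b = j₁₂ a b
  ... | inj₁ a | inj₂ b = j₁ a b
  ... | inj₂ a | inj₁ b = sym (j₂ b a)
  ... | inj₂ a | inj₂ b = jN a b
wf-sub Δ {N = N} (wf-lam {M} {L = K} w q) wN j jN =
  wf-lam (wf-sub (K ∷ Δ) w (wf-↑ [] wN) (λ {x} {L} {K} → jj {x} {L} {K}) (↑-⋄ N N jN)) q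
  where
  jj : M ⋄ ↑ 0 N
  jj rewrite fv-↑ {0} N = j

beta-preserves-wf : ∀ {Γ M M′ K} → WF Γ M K → Beta Γ M M′ → WF Γ M′ K
beta-preserves-wf {Γ} (wf-app (wf-lam wM _) wN _ j) (β-contract {N = N} d) =
  wf-sub [] wM (subst (WF Γ N) (trans (sym (wf-deg wN)) d) wN) j (wf-self wN)
beta-preserves-wf (wf-app w w′ q j) (β-appˡ s) =
  wf-app (beta-preserves-wf w s) w′ q (⋈-mono (beta-fv s) ⊆-refl j)
beta-preserves-wf (wf-app w w′ q j) (β-appʳ s) =
  wf-app w (beta-preserves-wf w′ s) q (⋈-mono ⊆-refl (beta-fv s) j)
beta-preserves-wf (wf-lam w q) (β-lam s) = wf-lam (beta-preserves-wf w s) q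

eta-preserves-wf : ∀ {Γ M M′ K} → WF Γ M K → Eta M M′ → WF Γ M′ K
eta-preserves-wf (wf-lam (wf-app w _ _ _) q) (η-contract {M = M} refl) = wf-↑⁻¹ [] M w
eta-preserves-wf (wf-app w w′ q j) (η-appˡ s) =
  wf-app (eta-preserves-wf w s) w′ q (⋈-mono (eta-fv s) ⊆-refl j)
eta-preserves-wf (wf-app w w′ q j) (η-appʳ s) =
  wf-app w (eta-preserves-wf w′ s) q (⋈-mono ⊆-refl (eta-fv s) j)
eta-preserves-wf (wf-lam w q) (η-lam s) = wf-lam (eta-preserves-wf w s) q

PreservesWF : Ctx → Rel Tm 0ℓ → Set
PreservesWF Γ R = ∀ {M M′ K} → WF Γ M K → R M M′ → WF Γ M′ K

Realised : Ctx → Rel Tm 0ℓ → Rel Tm 0ℓ → Set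
Realised Γ R C = ∀ {M M′ K} → WF Γ M K → R M M′ → C M M′

realise-star : ∀ {Γ R C} → PreservesWF Γ R → Realised Γ R C →
               ∀ {M M′} → TermIn Γ M → Star R M M′ → Star C M M′
realise-star pres real t ε = ε
realise-star pres real (K , w) (s ◅ ss) = real w s ◅ realise-star pres real (K , pres w s) ss

beta-realised : ∀ {r Γ} → (r ≡ β ⊎ r ≡ βη) → Realised Γ (Beta Γ) (CStep r Γ)
beta-realised {Γ = Γ} e w@(wf-app (wf-lam _ _) wN _ _) s@(β-contract {N = N} d) =
  ax (β-ax e (_ , w) (subst (WF Γ N) (trans (sym (wf-deg wN)) d) wN) (_ , beta-preserves-wf w s))
beta-realised e w@(wf-app wM _ _ _) s@(β-appˡ s′) =
  appˡ (beta-realised e wM s′) (_ , w) (_ , beta-preserves-wf w s)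
beta-realised e w@(wf-app _ wN _ _) s@(β-appʳ s′) =
  appʳ (beta-realised e wN s′) (_ , w) (_ , beta-preserves-wf w s)
beta-realised e w@(wf-lam wM _) s@(β-lam s′) =
  lam (beta-realised e wM s′) (_ , w) (_ , beta-preserves-wf w s)

eta-realised : ∀ {Γ} → Realised Γ Eta (CStep βη Γ)
eta-realised w s@(η-contract refl) = ax (η-ax (_ , w) (_ , eta-preserves-wf w s))
eta-realised w@(wf-app wM _ _ _) s@(η-appˡ s′) =
  appˡ (eta-realised wM s′) (_ , w) (_ , eta-preserves-wf w s)
eta-realised w@(wf-app _ wN _ _) s@(η-appʳ s′) =
  appʳ (eta-realised wN s′) (_ , w) (_ , eta-preserves-wf w s)
eta-realised w@(wf-lam wM _) s@(η-lam s′) =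
  lam (eta-realised wM s′) (_ , w) (_ , eta-preserves-wf w s)

beta-eta-preserves-wf : ∀ {Γ} → PreservesWF Γ (Beta Γ ∪ Eta)
beta-eta-preserves-wf w (inj₁ s) = beta-preserves-wf w s
beta-eta-preserves-wf w (inj₂ s) = eta-preserves-wf w s

beta-eta-realised : ∀ {Γ} → Realised Γ (Beta Γ ∪ Eta) (CStep βη Γ)
beta-eta-realised w (inj₁ s) = beta-realised (inj₂ refl) w s
beta-eta-realised w (inj₂ s) = eta-realised w s

step⇒beta : ∀ {Γ} → CStep β Γ ⇒ Beta Γ
step⇒beta (ax (β-ax _ _ wN _)) = β-contract (wf-deg wN)
step⇒beta (appˡ s _ _) = β-appˡ (step⇒beta s)
step⇒beta (appʳ s _ _) = β-appʳ (step⇒beta s)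
step⇒beta (lam s _ _) = β-lam (step⇒beta s)

step⇒beta-eta : ∀ {Γ} → CStep βη Γ ⇒ Beta Γ ∪ Eta
step⇒beta-eta (ax (β-ax _ _ wN _)) = inj₁ (β-contract (wf-deg wN))
step⇒beta-eta (ax (η-ax _ _)) = inj₂ (η-contract refl)
step⇒beta-eta (appˡ s _ _) = ⊎-map β-appˡ η-appˡ (step⇒beta-eta s)
step⇒beta-eta (appʳ s _ _) = ⊎-map β-appʳ η-appʳ (step⇒beta-eta s)
step⇒beta-eta (lam s _ _) = ⊎-map β-lam η-lam (step⇒beta-eta s)

cstep-terms : ∀ {r Γ M N} → CStep r Γ M N → TermIn Γ M × TermIn Γ N
cstep-terms (ax (β-ax _ t _ t′)) = t , t′
cstep-terms (ax (η-ax t t′)) = t , t′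
cstep-terms (appˡ _ t t′) = t , t′
cstep-terms (appʳ _ t t′) = t , t′
cstep-terms (lam _ t t′) = t , t′

step-terms : (r : Red) → ∀ {M N} → M ▷[ r ] N → Term M × Term N
step-terms β = cstep-terms
step-terms βη = cstep-terms
step-terms h (hβ t _ t′) = t , t′
step-terms h (happ _ t t′) = t , t′

head-deterministic : ∀ {M N N′} → HStep M N → HStep M N′ → N ≡ N′
head-deterministic (hβ _ _ _) (hβ _ _ _) = refl
head-deterministic (happ s _ _) (happ s′ _ _) = cong (_· _) (head-deterministic s s′)

-- Confluence of relations between terms, and its consequences (1) and (2).

module OnTerms (R : Rel Tm 0ℓ) (relates-terms : ∀ {M N} → R M N → Term M × Term N) where

  reduct-term : ∀ {M N} → Term M → Star R M N → Term N
  reduct-term t ε = t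
  reduct-term t (s ◅ ss) = reduct-term (proj₂ (relates-terms s)) ss

  -- Since R only relates terms, a divergence from a non-term is trivial,
  -- so confluence needs checking only from terms.
  confluent-from-terms : (∀ {M M₁ M₂} → Term M → Star R M M₁ → Star R M M₂ →
                          ∃ λ M′ → Star R M₁ M′ × Star R M₂ M′) → Confluent R
  confluent-from-terms conf {C = M₂} ε q = M₂ , q , ε
  confluent-from-terms conf p@(s ◅ _) q = conf (proj₁ (relates-terms s)) p q

  confluence-transfer : ∀ {S} → R ⇒ S → PreservesWF [] S → Realised [] S R →
                        Confluent S → Confluent R
  confluence-transfer R⊆S pres real confS = confluent-from-terms λ t p q →
    let d , bd , cd = confS (Star.map R⊆S p) (Star.map R⊆S q)
    in d , realise-star pres real (reduct-term t p) bd , realise-star pres real (reduct-term t q) cd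

  module _ (conf : Confluent R) where

    common-reduct : ∀ M M₁ M₂ → Term M → Term M₁ → Term M₂ → Star R M M₁ → Star R M M₂ →
                    ∃ λ M′ → Term M′ × Star R M₁ M′ × Star R M₂ M′
    common-reduct _ _ _ _ t₁ _ p q =
      let M′ , p′ , q′ = conf p q in M′ , reduct-term t₁ p′ , p′ , q′

    -- Part (2), ⇒: a conversion zig-zag closes to a common reduct; each
    -- backward step is absorbed by confluence.
    convertible⇒joinable : ∀ {M₁ M₂} → Term M₁ → EqClosure R M₁ M₂ →
                           ∃ λ M → Term M × Star R M₁ M × Star R M₂ M
    convertible⇒joinable t c =
      let M , p , q = close c in M , reduct-term t p , p , q
      where
      close : ∀ {a b} → EqClosure R a b → ∃ λ d → Star R a d × Star R b d
      close {a} ε = a , ε , ε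
      close (fwd s ◅ c) = let d , p , q = close c in d , s ◅ p , q
      close (bwd s ◅ c) =
        let d , p , q = close c
            d′ , p′ , q′ = conf (s ◅ ε) p
        in d′ , p′ , q ◅◅ q′

  joinable⇒convertible : ∀ {M₁ M₂} → (∃ λ M → Term M × Star R M₁ M × Star R M₂ M) →
                         EqClosure R M₁ M₂
  joinable⇒convertible (_ , _ , p , q) = a—↠b⇒a↔b p ◅◅ a—↠b⇒b↔a q

module OnRed (r : Red) = OnTerms (λ M N → M ▷[ r ] N) (step-terms r)

church-rosser : (r : Red) → Confluent (λ M N → M ▷[ r ] N)
church-rosser β =
  OnRed.confluence-transfer β step⇒beta beta-preserves-wf (beta-realised (inj₁ refl)) beta-confluent
church-rosser βη =
  OnRed.confluence-transfer βη step⇒beta-eta beta-eta-preserves-wf beta-eta-realised beta-eta-confluent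
church-rosser h = det⇒conf head-deterministic

theorem2 : (r : Red) →
    (∀ M M₁ M₂ → Term M → Term M₁ → Term M₂ →
       M ▷*[ r ] M₁ → M ▷*[ r ] M₂ →
       ∃ λ M′ → Term M′ × M₁ ▷*[ r ] M′ × M₂ ▷*[ r ] M′)
    ×
    (∀ M₁ M₂ → Term M₁ → Term M₂ →
       (M₁ ≃[ r ] M₂ → ∃ λ M → Term M × M₁ ▷*[ r ] M × M₂ ▷*[ r ] M)
       ×
       ((∃ λ M → Term M × M₁ ▷*[ r ] M × M₂ ▷*[ r ] M) → M₁ ≃[ r ] M₂))
theorem2 r =
  common-reduct (church-rosser r) ,
  λ M₁ M₂ t₁ _ → convertible⇒joinable (church-rosser r) t₁ , joinable⇒convertible
  where open OnRed r
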